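{- Let $n\ge 2$, $1\le k\le n-1$, and let $G_1$ be a connected simple graph of order $n$ with edge connectivity $k$ having a $k$-edge cut $\partial(S)$ such that $G_1[S]\cong K_m$, $G_1[\bar S]\cong K_{n-m}$ (where $\bar S=V(G_1)\setminus S$) and $k\le m\le\lfloor n/2\rfloor$. Suppose $u_1,u_2\in\bar S$, $v_1,v_2\in S$, that $e_1=u_1v_1$ and $e_2=u_1v_2$ are two distinct edges of $\partial(S)$, and that $u_2$ is not incident with any edge of $\partial(S)$. Let $G_2$ be obtained from $G_1$ by deleting $e_2$ and adding the new edge $u_2v_2$. Then $G_1\prec G_2$.
   Context: For $S\subsetneq V(G)$ nonempty, the edge cut $\partial(S)$ is the set of edges with exactly one end in $S$; a $k$-edge cut has exactly $k$ edges. $G[S]$ denotes the induced subgraph. $m(G,t)$ is the number of $t$-matchings of $G$, $m(G,0)=1$. For graphs $G_1,G_2$ of order $n$, $G_1\preceq G_2$ means $m(G_1,t)\le m(G_2,t)$ for all $t=0,\dots,\lfloor n/2\rfloor$; $G_1\prec G_2$ means $G_1\preceq G_2$ and strict inequality holds for some $t$. -}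

module Defs where

open import Data.Bool using (Bool; true; false; _∧_; _∨_; _xor_; not; if_then_else_; T)
open import Data.Nat using (ℕ; zero; suc; _≤_; _<_; ⌊_/2⌋)
open import Data.Fin using (Fin; _<?_) renaming (_≟_ to _≟ᶠ_)
open import Data.Fin.Subset using (Subset; Nonempty; ∁; ∣_∣; _∈_; _∉_)
open import Data.List using (List; []; _∷_; length; filterᵇ; allFin; concatMap; map; _++_)
open import Data.Product using (_×_; _,_; proj₁; proj₂; ∃; Σ-syntax)
open import Data.Vec using (lookup)
open import Relation.Nullary using (¬_)
open import Relation.Nullary.Decidable using (⌊_⌋)
open import Relation.Binary.PropositionalEquality using (_≡_; _≢_)

Graph : ℕ → Set
Graph n = Fin n → Fin n → Bool

Adj : ∀ {n} → Graph n → Fin n → Fin n → Set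
Adj G x y = G x y ≡ true

record IsSimple {n : ℕ} (G : Graph n) : Set where
  field
    sym     : ∀ x y → G x y ≡ G y x
    irrefl  : ∀ x → G x x ≡ false

data Reach {n : ℕ} (G : Graph n) : Fin n → Fin n → Set where
  here : ∀ {x} → Reach G x x
  step : ∀ {x y z} → Adj G x y → Reach G y z → Reach G x z

Connected : ∀ {n} → Graph n → Set
Connected G = ∀ x y → Reach G x y

pairs : (n : ℕ) → List (Fin n × Fin n)
pairs n = concatMap (λ i → map (λ j → (i , j)) (allFin n)) (allFin n)

edges : ∀ {n} → Graph n → List (Fin n × Fin n)
edges {n} G = filterᵇ (λ e → ⌊ proj₁ e <? proj₂ e ⌋ ∧ G (proj₁ e) (proj₂ e)) (pairs n)

inS : ∀ {n} → Subset n → Fin n → Bool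
inS S x = lookup S x

cut : ∀ {n} → Graph n → Subset n → List (Fin n × Fin n)
cut G S = filterᵇ (λ e → inS S (proj₁ e) xor inS S (proj₂ e)) (edges G)

NonemptyProper : ∀ {n} → Subset n → Set
NonemptyProper S = Nonempty S × Nonempty (∁ S)

EdgeConnectivity : ∀ {n} → Graph n → ℕ → Set
EdgeConnectivity G k =
  (∀ S → NonemptyProper S → k ≤ length (cut G S)) ×
  (∃ λ S → NonemptyProper S × length (cut G S) ≡ k)

InducedComplete : ∀ {n} → Graph n → Subset n → ℕ → Set
InducedComplete G S m = ∣ S ∣ ≡ m × (∀ x y → x ∈ S → y ∈ S → x ≢ y → Adj G x y)

sublists : ∀ {A : Set} → List A → List (List A)
sublists [] = [] ∷ []
sublists (x ∷ xs) = let r = sublists xs in map (x ∷_) r ++ r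

disjointᵇ : ∀ {n} → Fin n × Fin n → Fin n × Fin n → Bool
disjointᵇ (a , b) (c , d) =
  not (⌊ a ≟ᶠ c ⌋ ∨ ⌊ a ≟ᶠ d ⌋ ∨ ⌊ b ≟ᶠ c ⌋ ∨ ⌊ b ≟ᶠ d ⌋)

allᵇ : ∀ {A : Set} → (A → Bool) → List A → Bool
allᵇ p [] = true
allᵇ p (x ∷ xs) = p x ∧ allᵇ p xs

isMatchingᵇ : ∀ {n} → List (Fin n × Fin n) → Bool
isMatchingᵇ [] = true
isMatchingᵇ (e ∷ es) = allᵇ (disjointᵇ e) es ∧ isMatchingᵇ es

-- m(G,t): number of t-matchings of G (sets of t pairwise disjoint edges).
-- Since edges G has no duplicates, sublists enumerates each edge set once.
matchings : ∀ {n} → Graph n → ℕ → List (List (Fin n × Fin n))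
matchings G t =
  filterᵇ (λ M → ⌊ length M Data.Nat.≟ t ⌋ ∧ isMatchingᵇ M) (sublists (edges G))

matchNum : ∀ {n} → Graph n → ℕ → ℕ
matchNum G t = length (matchings G t)

_≼_ : ∀ {n} → Graph n → Graph n → Set
_≼_ {n} G₁ G₂ = ∀ t → t ≤ ⌊ n /2⌋ → matchNum G₁ t ≤ matchNum G₂ t

_≺_ : ∀ {n} → Graph n → Graph n → Set
_≺_ {n} G₁ G₂ = G₁ ≼ G₂ × (∃ λ t → t ≤ ⌊ n /2⌋ × matchNum G₁ t < matchNum G₂ t)

sameEdge : ∀ {n} → Fin n → Fin n → Fin n → Fin n → Bool
sameEdge a b x y = (⌊ x ≟ᶠ a ⌋ ∧ ⌊ y ≟ᶠ b ⌋) ∨ (⌊ x ≟ᶠ b ⌋ ∧ ⌊ y ≟ᶠ a ⌋)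

moveEdge : ∀ {n} → Graph n → Fin n → Fin n → Fin n → Fin n → Graph n
moveEdge G a b c d x y =
  if sameEdge a b x y then false else (if sameEdge c d x y then true else G x y)

-- Proof by an explicit injection φ from the t-matchings of G₁ into those of
-- G₂ = G₁ - u₁v₂ + u₂v₂.  A matching avoiding u₁v₂ is kept; a matching using
-- u₁v₂ is relabelled by the transposition (u₁ u₂).  This is valid because u₂ has
-- no neighbour in S and u₁ is adjacent to every vertex outside S.  The edge
-- u₂v₂ records which case occurred, so φ is injective, and the 2-matching
-- {u₁v₁, u₂v₂} of G₂ is not hit.
module Submission where

open import Defs
open import Data.Nat using (ℕ; _≤_; _∸_; ⌊_/2⌋)
open import Data.Fin using (Fin)
open import Data.List using (length)
open import Data.Fin.Subset using (Subset; ∁; _∈_; _∉_)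
open import Relation.Nullary using (¬_)
open import Relation.Binary.PropositionalEquality using (_≡_; _≢_)

open import Data.Bool using (Bool; true; false; T; _∧_)
open import Data.Bool.Properties using (T-≡; T-∧; ∧-comm; ∨-comm)
open import Data.Empty using (⊥; ⊥-elim)
open import Data.Fin using () renaming (_<_ to _<ᶠ_; _<?_ to _<?ᶠ_; _≟_ to _≟ᶠ_)
open import Data.Fin.Permutation using (Permutation; _⟨$⟩ʳ_; _⟨$⟩ˡ_; inverseˡ; inverseʳ)
import Data.Fin.Permutation as Perm
open import Data.Fin.Permutation.Components using (transpose)
open import Data.Fin.Properties using (<-cmp; <-asym; <⇒≢)
open import Data.Fin.Subset using (∣_∣; _-_)
open import Data.Fin.Subset.Properties
  using (x∈p⇒∣p-x∣<∣p∣; x∈p∧x∉q⇒x∈p─q; x∈⁅y⁆⇒x≡y; x∉p⇒x∈∁p)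
open import Data.List using (List; []; _∷_; _++_; map; filterᵇ; concatMap; cartesianProduct; allFin)
open import Data.List.Properties using (length-map; length-removeAt′; ∷-injectiveʳ)
open import Data.List.Membership.Propositional using () renaming (_∈_ to _∈ₗ_; _∉_ to _∉ₗ_)
open import Data.List.Membership.Propositional.Properties
  using (∈-map⁺; ∈-map⁻; ∈-++⁺ˡ; ∈-++⁺ʳ; ∈-++⁻; ∈-filter⁺; ∈-filter⁻; ∈-cartesianProduct⁺; ∈-allFin)
open import Data.List.Relation.Unary.All using (All; []; _∷_)
import Data.List.Relation.Unary.All as All
import Data.List.Relation.Unary.All.Properties as All
open import Data.List.Relation.Unary.AllPairs using ([]; _∷_)
open import Data.List.Relation.Unary.Any using (here; there; index; _─_; any?)
open import Data.List.Relation.Unary.Unique.Propositional using (Unique)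
import Data.List.Relation.Unary.Unique.Propositional.Properties as Unique
open import Data.Nat using (suc; _<_; z≤n; s≤s; _≟_)
open import Data.Nat.Properties using (≤-trans; ≤-antisym)
open import Data.Product using (_×_; _,_; proj₁; proj₂; ∃)
open import Data.Product.Properties using () renaming (≡-dec to ×-≡-dec)
open import Data.Sum using (_⊎_; inj₁; inj₂)
import Data.Sum as Sum
open import Function using (_∘_; Equivalence)
open import Relation.Binary.Definitions using (DecidableEquality; tri<; tri≈; tri>)
open import Relation.Binary.PropositionalEquality using (refl; sym; trans; cong; cong₂; subst; subst₂)
open import Relation.Nullary using (Dec; yes; no)
open import Relation.Nullary.Decidable
  using (T?; ⌊_⌋; toWitness; fromWitness; dec-true; dec-false; isYes≗does)

-- Counting by injections between lists without duplicates.
module _ {A : Set} where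

  ∈-─ : ∀ {y z} {ys : List A} → z ∈ₗ ys → (p : y ∈ₗ ys) → z ≢ y → z ∈ₗ (ys ─ p)
  ∈-─ (here refl) (here refl) z≢y = ⊥-elim (z≢y refl)
  ∈-─ (here z≡x)  (there p)   _   = here z≡x
  ∈-─ (there z∈)  (here _)    _   = z∈
  ∈-─ (there z∈)  (there p)   z≢y = there (∈-─ z∈ p z≢y)

  Unique-⊆-length : ∀ {xs ys : List A} → Unique xs → (∀ {z} → z ∈ₗ xs → z ∈ₗ ys) →
                    length xs ≤ length ys
  Unique-⊆-length {[]}     _            _   = z≤n
  Unique-⊆-length {x ∷ xs} {ys} (x∉ ∷ u) sub =
    subst (suc (length xs) ≤_) (sym (length-removeAt′ ys (index x∈ys)))
      (s≤s (Unique-⊆-length u (λ z∈ → ∈-─ (sub (there z∈)) x∈ys (z≢x z∈))))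
    where
    x∈ys = sub (here refl)
    z≢x : ∀ {z} → z ∈ₗ xs → z ≢ x
    z≢x z∈ z≡x = All.lookup x∉ z∈ (sym z≡x)

module _ {A B : Set} (f : A → B) where

  InjectiveOn : List A → Set
  InjectiveOn xs = ∀ {x y} → x ∈ₗ xs → y ∈ₗ xs → f x ≡ f y → x ≡ y

  map-Unique : ∀ {xs} → Unique xs → InjectiveOn xs → Unique (map f xs)
  map-Unique {[]}     []        _   = []
  map-Unique {x ∷ xs} (x∉ ∷ u) inj =
    All.map⁺ (All.tabulate (λ y∈ fx≡fy → All.lookup x∉ y∈ (inj (here refl) (there y∈) fx≡fy)))
    ∷ map-Unique u (λ x∈ y∈ → inj (there x∈) (there y∈))

  injection-≤ : ∀ {xs ys} → Unique xs → InjectiveOn xs → (∀ {x} → x ∈ₗ xs → f x ∈ₗ ys) →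
                length xs ≤ length ys
  injection-≤ {xs} u inj into = subst (_≤ _) (length-map f xs)
    (Unique-⊆-length (map-Unique u inj) image⊆)
    where
    image⊆ : ∀ {z} → z ∈ₗ map f xs → z ∈ₗ _
    image⊆ z∈ with ∈-map⁻ f z∈
    ... | _ , x∈ , refl = into x∈

  injection-< : ∀ {xs ys} (b : B) → Unique xs → InjectiveOn xs → (∀ {x} → x ∈ₗ xs → f x ∈ₗ ys) →
                b ∈ₗ ys → (∀ {x} → x ∈ₗ xs → f x ≢ b) → length xs < length ys
  injection-< {xs} b u inj into b∈ missed = subst (_< _) (length-map f xs)
    (Unique-⊆-length (b∉image ∷ map-Unique u inj) image⊆)
    where
    b∉image : All (b ≢_) (map f xs)
    b∉image = All.map⁺ (All.tabulate (λ x∈ b≡fx → missed x∈ (sym b≡fx)))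
    image⊆ : ∀ {z} → z ∈ₗ b ∷ map f xs → z ∈ₗ _
    image⊆ (here refl) = b∈
    image⊆ (there z∈) with ∈-map⁻ f z∈
    ... | _ , x∈ , refl = into x∈

module _ {A : Set} (p : A → Bool) where

  ∈-filterᵇ⁻ : ∀ {x xs} → x ∈ₗ filterᵇ p xs → x ∈ₗ xs × T (p x)
  ∈-filterᵇ⁻ = ∈-filter⁻ (T? ∘ p)

  ∈-filterᵇ⁺ : ∀ {x xs} → x ∈ₗ xs → T (p x) → x ∈ₗ filterᵇ p xs
  ∈-filterᵇ⁺ = ∈-filter⁺ (T? ∘ p)

  filterᵇ-Unique : ∀ {xs} → Unique xs → Unique (filterᵇ p xs)
  filterᵇ-Unique = Unique.filter⁺ (T? ∘ p)

  filterᵇ∈sublists : ∀ xs → filterᵇ p xs ∈ₗ sublists xs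
  filterᵇ∈sublists []       = here refl
  filterᵇ∈sublists (x ∷ xs) with p x
  ... | true  = ∈-++⁺ˡ (∈-map⁺ (x ∷_) (filterᵇ∈sublists xs))
  ... | false = ∈-++⁺ʳ (map (x ∷_) (sublists xs)) (filterᵇ∈sublists xs)

module _ {A : Set} where

  sublists-∷⁻ : ∀ {x : A} {xs L} → L ∈ₗ sublists (x ∷ xs) →
                (∃ λ L′ → L′ ∈ₗ sublists xs × L ≡ x ∷ L′) ⊎ L ∈ₗ sublists xs
  sublists-∷⁻ {x} {xs} L∈ with ∈-++⁻ (map (x ∷_) (sublists xs)) L∈
  ... | inj₁ L∈₁ = inj₁ (∈-map⁻ (x ∷_) L∈₁)
  ... | inj₂ L∈₂ = inj₂ L∈₂

  sublist-⊆ : ∀ {xs L} {e : A} → L ∈ₗ sublists xs → e ∈ₗ L → e ∈ₗ xs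
  sublist-⊆ {[]} (here refl) ()
  sublist-⊆ {x ∷ xs} L∈ e∈ with sublists-∷⁻ {x} {xs} L∈ | e∈
  ... | inj₁ (_ , _   , refl) | here e≡x = here e≡x
  ... | inj₁ (_ , L′∈ , refl) | there e∈′ = there (sublist-⊆ L′∈ e∈′)
  ... | inj₂ L∈′ | _ = there (sublist-⊆ L∈′ e∈)

  sublist-Unique : ∀ {xs L : List A} → Unique xs → L ∈ₗ sublists xs → Unique L
  sublist-Unique {[]} _ (here refl) = []
  sublist-Unique {x ∷ xs} (x∉ ∷ u) L∈ with sublists-∷⁻ {x} {xs} L∈
  ... | inj₁ (_ , L′∈ , refl) =
    All.tabulate (λ e∈ → All.lookup x∉ (sublist-⊆ L′∈ e∈)) ∷ sublist-Unique u L′∈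
  ... | inj₂ L∈′ = sublist-Unique u L∈′

  sublists-Unique : ∀ {xs : List A} → Unique xs → Unique (sublists xs)
  sublists-Unique {[]}     _        = [] ∷ []
  sublists-Unique {x ∷ xs} (x∉ ∷ u) =
    Unique.++⁺ (Unique.map⁺ ∷-injectiveʳ (sublists-Unique u)) (sublists-Unique u) apart
    where
    apart : ∀ {L} → L ∈ₗ map (x ∷_) (sublists xs) × L ∈ₗ sublists xs → ⊥
    apart (L∈₁ , L∈₂) with ∈-map⁻ (x ∷_) L∈₁
    ... | _ , _ , refl = All.lookup x∉ (sublist-⊆ L∈₂ (here refl)) refl

  sublist-ext : ∀ {xs L₁ L₂ : List A} → Unique xs → L₁ ∈ₗ sublists xs → L₂ ∈ₗ sublists xs →
                (∀ {e} → e ∈ₗ L₁ → e ∈ₗ L₂) → (∀ {e} → e ∈ₗ L₂ → e ∈ₗ L₁) → L₁ ≡ L₂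
  sublist-ext {[]} _ (here refl) (here refl) _ _ = refl
  sublist-ext {x ∷ xs} (x∉ ∷ u) L₁∈ L₂∈ sub₁ sub₂ with sublists-∷⁻ {x} {xs} L₁∈ | sublists-∷⁻ {x} {xs} L₂∈
  ... | inj₁ (L₁′ , L₁′∈ , refl) | inj₁ (L₂′ , L₂′∈ , refl) =
    cong (x ∷_) (sublist-ext u L₁′∈ L₂′∈ (λ e∈ → tail (sub₁ (there e∈)) (sublist-⊆ L₁′∈ e∈))
                                         (λ e∈ → tail (sub₂ (there e∈)) (sublist-⊆ L₂′∈ e∈)))
    where
    tail : ∀ {L e} → e ∈ₗ x ∷ L → e ∈ₗ xs → e ∈ₗ L
    tail (here refl) e∈xs = ⊥-elim (All.lookup x∉ e∈xs refl)
    tail (there e∈)  _    = e∈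
  ... | inj₁ (_ , _ , refl) | inj₂ L₂∈′ = ⊥-elim (All.lookup x∉ (sublist-⊆ L₂∈′ (sub₁ (here refl))) refl)
  ... | inj₂ L₁∈′ | inj₁ (_ , _ , refl) = ⊥-elim (All.lookup x∉ (sublist-⊆ L₁∈′ (sub₂ (here refl))) refl)
  ... | inj₂ L₁∈′ | inj₂ L₂∈′ = sublist-ext u L₁∈′ L₂∈′ sub₁ sub₂

-- Edges of graphs on Fin n.  An edge {a,b} is stored as the canonical pair
-- (a , b) with a < b; `edge x y` puts two distinct vertices in that form.
Edge : ℕ → Set
Edge n = Fin n × Fin n

_≟ₑ_ : ∀ {n} → DecidableEquality (Edge n)
_≟ₑ_ = ×-≡-dec _≟ᶠ_ _≟ᶠ_

_∈ₗ?_ : ∀ {n} (e : Edge n) (M : List (Edge n)) → Dec (e ∈ₗ M)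
e ∈ₗ? M = any? (e ≟ₑ_) M

module _ {n : ℕ} where

  Canonical : Edge n → Set
  Canonical e = proj₁ e <ᶠ proj₂ e

  edge : Fin n → Fin n → Edge n
  edge x y with x <?ᶠ y
  ... | yes _ = x , y
  ... | no  _ = y , x

  edge-cases : ∀ x y → edge x y ≡ (x , y) ⊎ edge x y ≡ (y , x)
  edge-cases x y with x <?ᶠ y
  ... | yes _ = inj₁ refl
  ... | no  _ = inj₂ refl

  edge-canonical : ∀ {x y} → x ≢ y → Canonical (edge x y)
  edge-canonical {x} {y} x≢y with x <?ᶠ y
  ... | yes x<y = x<y
  ... | no  x≮y with <-cmp x y
  ...   | tri< x<y _   _   = ⊥-elim (x≮y x<y)
  ...   | tri≈ _   x≡y _   = ⊥-elim (x≢y x≡y)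
  ...   | tri> _   _   y<x = y<x

  Canonical⇒≢ : ∀ {a b} → Canonical (a , b) → a ≢ b
  Canonical⇒≢ = <⇒≢

  edge-of-canonical : ∀ {a b x y} → Canonical (a , b) →
                      (x ≡ a × y ≡ b) ⊎ (x ≡ b × y ≡ a) → edge x y ≡ (a , b)
  edge-of-canonical {a} {b} a<b (inj₁ (refl , refl)) with a <?ᶠ b
  ... | yes _   = refl
  ... | no  a≮b = ⊥-elim (a≮b a<b)
  edge-of-canonical {a} {b} a<b (inj₂ (refl , refl)) with b <?ᶠ a
  ... | yes b<a = ⊥-elim (<-asym a<b b<a)
  ... | no  _   = refl

  edge-sym : ∀ {x y} → x ≢ y → edge x y ≡ edge y x
  edge-sym {x} {y} x≢y with edge-cases x y | edge-canonical x≢y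
  ... | inj₁ eq | canon rewrite eq = sym (edge-of-canonical canon (inj₂ (refl , refl)))
  ... | inj₂ eq | canon rewrite eq = sym (edge-of-canonical canon (inj₁ (refl , refl)))

  _∈ₑ_ : Fin n → Edge n → Set
  z ∈ₑ e = z ≡ proj₁ e ⊎ z ≡ proj₂ e

  ∈ₑ-edge⁻ : ∀ {x y z} → z ∈ₑ edge x y → z ∈ₑ (x , y)
  ∈ₑ-edge⁻ {x} {y} z∈ with edge-cases x y
  ... | inj₁ eq = subst (_ ∈ₑ_) eq z∈
  ... | inj₂ eq = Sum.swap (subst (_ ∈ₑ_) eq z∈)

  ∈ₑ-edge⁺ : ∀ {x y z} → z ∈ₑ (x , y) → z ∈ₑ edge x y
  ∈ₑ-edge⁺ {x} {y} z∈ with edge-cases x y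
  ... | inj₁ eq = subst (_ ∈ₑ_) (sym eq) z∈
  ... | inj₂ eq = subst (_ ∈ₑ_) (sym eq) (Sum.swap z∈)

  Disjoint : Edge n → Edge n → Set
  Disjoint e e′ = ∀ {z} → z ∈ₑ e → z ∈ₑ e′ → ⊥

  Disjoint-sym : ∀ {e e′} → Disjoint e e′ → Disjoint e′ e
  Disjoint-sym d z∈e′ z∈e = d z∈e z∈e′

  Disjoint⇒≢ : ∀ {e e′} → Disjoint e e′ → e ≢ e′
  Disjoint⇒≢ apart refl = apart (inj₁ refl) (inj₁ refl)

  disjointᵇ⇒Disjoint : ∀ e e′ → T (disjointᵇ e e′) → Disjoint e e′
  disjointᵇ⇒Disjoint (a , b) (c , d) t with a ≟ᶠ c | a ≟ᶠ d | b ≟ᶠ c | b ≟ᶠ d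
  ... | no a≢c | no a≢d | no b≢c | no b≢d = apart
    where
    apart : Disjoint (a , b) (c , d)
    apart (inj₁ refl) (inj₁ z≡c) = a≢c z≡c
    apart (inj₁ refl) (inj₂ z≡d) = a≢d z≡d
    apart (inj₂ refl) (inj₁ z≡c) = b≢c z≡c
    apart (inj₂ refl) (inj₂ z≡d) = b≢d z≡d
  disjointᵇ⇒Disjoint _ _ () | yes _ | _     | _     | _
  disjointᵇ⇒Disjoint _ _ () | no _  | yes _ | _     | _
  disjointᵇ⇒Disjoint _ _ () | no _  | no _  | yes _ | _
  disjointᵇ⇒Disjoint _ _ () | no _  | no _  | no _  | yes _

  Disjoint⇒disjointᵇ : ∀ e e′ → Disjoint e e′ → T (disjointᵇ e e′)
  Disjoint⇒disjointᵇ (a , b) (c , d) apart with a ≟ᶠ c | a ≟ᶠ d | b ≟ᶠ c | b ≟ᶠ d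
  ... | no _     | no _     | no _     | no _     = _
  ... | yes a≡c  | _        | _        | _        = apart (inj₁ refl) (inj₁ a≡c)
  ... | no _     | yes a≡d  | _        | _        = apart (inj₁ refl) (inj₂ a≡d)
  ... | no _     | no _     | yes b≡c  | _        = apart (inj₂ refl) (inj₁ b≡c)
  ... | no _     | no _     | no _     | yes b≡d  = apart (inj₂ refl) (inj₂ b≡d)

  private
    pairs≡cartesianProduct : ∀ (xs ys : List (Fin n)) →
      concatMap (λ i → map (λ j → (i , j)) ys) xs ≡ cartesianProduct xs ys
    pairs≡cartesianProduct []       ys = refl
    pairs≡cartesianProduct (x ∷ xs) ys = cong (map (x ,_) ys ++_) (pairs≡cartesianProduct xs ys)

  pairs-Unique : Unique (pairs n)
  pairs-Unique = subst Unique (sym (pairs≡cartesianProduct (allFin n) (allFin n)))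
    (Unique.cartesianProduct⁺ (Unique.allFin⁺ n) (Unique.allFin⁺ n))

  ∈-pairs : ∀ (e : Edge n) → e ∈ₗ pairs n
  ∈-pairs (a , b) = subst (_ ∈ₗ_) (sym (pairs≡cartesianProduct (allFin n) (allFin n)))
    (∈-cartesianProduct⁺ (∈-allFin a) (∈-allFin b))

  edges-Unique : ∀ G → Unique (edges {n} G)
  edges-Unique G = filterᵇ-Unique _ pairs-Unique

  ∈-edges⁻ : ∀ {G e} → e ∈ₗ edges {n} G → Canonical e × Adj G (proj₁ e) (proj₂ e)
  ∈-edges⁻ {G} {a , b} e∈
    with ∈-filterᵇ⁻ (λ e → ⌊ proj₁ e <?ᶠ proj₂ e ⌋ ∧ G (proj₁ e) (proj₂ e)) {xs = pairs n} e∈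
  ... | _ , t with Equivalence.to (T-∧ {⌊ a <?ᶠ b ⌋}) t
  ...   | a<b , adj = toWitness a<b , Equivalence.to T-≡ adj

  ∈-edges⁺ : ∀ {G a b} → Canonical (a , b) → Adj G a b → (a , b) ∈ₗ edges {n} G
  ∈-edges⁺ {G} {a} {b} a<b adj = ∈-filterᵇ⁺ _ (∈-pairs (a , b))
    (Equivalence.from T-∧ (fromWitness a<b , Equivalence.from T-≡ adj))

  Symmetric : Graph n → Set
  Symmetric G = ∀ x y → G x y ≡ G y x

  edge∈edges : ∀ {G x y} → Symmetric G → x ≢ y → Adj G x y → edge x y ∈ₗ edges G
  edge∈edges {G} {x} {y} sym-G x≢y adj with edge-cases x y | edge-canonical x≢y
  ... | inj₁ eq | canon rewrite eq = ∈-edges⁺ canon adj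
  ... | inj₂ eq | canon rewrite eq = ∈-edges⁺ canon (trans (sym-G y x) adj)

  edge∈edges⁻ : ∀ {G x y} → Symmetric G → edge x y ∈ₗ edges G → Adj G x y
  edge∈edges⁻ {G} {x} {y} sym-G e∈ with edge-cases x y
  ... | inj₁ eq rewrite eq = proj₂ (∈-edges⁻ e∈)
  ... | inj₂ eq rewrite eq = trans (sym-G x y) (proj₂ (∈-edges⁻ e∈))

  Adj-edge : ∀ {G} (f : Fin n → Fin n) {x y} → Symmetric G → Adj G (f x) (f y) →
             Adj G (f (proj₁ (edge x y))) (f (proj₂ (edge x y)))
  Adj-edge f {x} {y} sym-G adj with edge-cases x y
  ... | inj₁ eq rewrite eq = adj
  ... | inj₂ eq rewrite eq = trans (sym-G (f y) (f x)) adj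

  PairwiseDisjoint : List (Edge n) → Set
  PairwiseDisjoint M = ∀ {e e′} → e ∈ₗ M → e′ ∈ₗ M → e ≢ e′ → Disjoint e e′

  record Matching (M : List (Edge n)) : Set where
    field
      unique    : Unique M
      canonical : ∀ {e} → e ∈ₗ M → Canonical e
      disjoint  : PairwiseDisjoint M

  private
    allᵇ⁻ : ∀ {A : Set} {p : A → Bool} {xs} → T (allᵇ p xs) → All (T ∘ p) xs
    allᵇ⁻ {xs = []}     _ = []
    allᵇ⁻ {p = p} {x ∷ xs} t with Equivalence.to (T-∧ {p x}) t
    ... | px , rest = px ∷ allᵇ⁻ rest

    allᵇ⁺ : ∀ {A : Set} {p : A → Bool} {xs} → All (T ∘ p) xs → T (allᵇ p xs)
    allᵇ⁺ []         = _
    allᵇ⁺ (px ∷ pxs) = Equivalence.from T-∧ (px , allᵇ⁺ pxs)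

  isMatchingᵇ⇒PairwiseDisjoint : ∀ {M} → T (isMatchingᵇ M) → PairwiseDisjoint M
  isMatchingᵇ⇒PairwiseDisjoint {d ∷ M} t e∈ e′∈ e≢e′
    with Equivalence.to (T-∧ {allᵇ (disjointᵇ d) M}) t | e∈ | e′∈
  ... | _ , _    | here refl | here refl = ⊥-elim (e≢e′ refl)
  ... | hd , _   | here refl | there j   = disjointᵇ⇒Disjoint _ _ (All.lookup (allᵇ⁻ hd) j)
  ... | hd , _   | there i   | here refl = Disjoint-sym (disjointᵇ⇒Disjoint _ _ (All.lookup (allᵇ⁻ hd) i))
  ... | _ , rest | there i   | there j   = isMatchingᵇ⇒PairwiseDisjoint rest i j e≢e′

  PairwiseDisjoint⇒isMatchingᵇ : ∀ {M} → Unique M → PairwiseDisjoint M → T (isMatchingᵇ M)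
  PairwiseDisjoint⇒isMatchingᵇ {[]}    _        _     = _
  PairwiseDisjoint⇒isMatchingᵇ {d ∷ M} (d∉ ∷ u) apart = Equivalence.from T-∧
    ( allᵇ⁺ (All.tabulate (λ e∈ → Disjoint⇒disjointᵇ _ _ (apart (here refl) (there e∈) (All.lookup d∉ e∈))))
    , PairwiseDisjoint⇒isMatchingᵇ u (λ i j → apart (there i) (there j)))

  ∈-matchings⁻ : ∀ {G t M} → M ∈ₗ matchings {n} G t →
                 M ∈ₗ sublists (edges G) × length M ≡ t × T (isMatchingᵇ M)
  ∈-matchings⁻ {G} {t} {M} M∈
    with ∈-filterᵇ⁻ (λ M → ⌊ length M ≟ t ⌋ ∧ isMatchingᵇ M) {xs = sublists (edges G)} M∈
  ... | M∈sub , p with Equivalence.to (T-∧ {⌊ length M ≟ t ⌋}) p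
  ...   | len , isM = M∈sub , toWitness len , isM

  ∈-matchings⁺ : ∀ {G t M} → M ∈ₗ sublists (edges G) → length M ≡ t → T (isMatchingᵇ M) →
                 M ∈ₗ matchings {n} G t
  ∈-matchings⁺ M∈sub len isM =
    ∈-filterᵇ⁺ _ M∈sub (Equivalence.from T-∧ (fromWitness len , isM))

  matchings-⊆ : ∀ {G t M e} → M ∈ₗ matchings {n} G t → e ∈ₗ M → e ∈ₗ edges G
  matchings-⊆ M∈ = sublist-⊆ (proj₁ (∈-matchings⁻ M∈))

  matchings-Unique : ∀ G t → Unique (matchings {n} G t)
  matchings-Unique G t = filterᵇ-Unique _ (sublists-Unique (edges-Unique G))

  matchings-Matching : ∀ {G t M} → M ∈ₗ matchings {n} G t → Matching M
  matchings-Matching {G} M∈ with ∈-matchings⁻ M∈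
  ... | M∈sub , _ , isM = record
    { unique    = sublist-Unique (edges-Unique G) M∈sub
    ; canonical = λ e∈ → proj₁ (∈-edges⁻ (matchings-⊆ M∈ e∈))
    ; disjoint  = isMatchingᵇ⇒PairwiseDisjoint isM
    }

mapEdge : ∀ {n} → (Fin n → Fin n) → Edge n → Edge n
mapEdge f e = edge (f (proj₁ e)) (f (proj₂ e))

mapEdge-id : ∀ {n} {e : Edge n} → Canonical e → mapEdge (λ x → x) e ≡ e
mapEdge-id canon = edge-of-canonical canon (inj₁ (refl , refl))

mapEdge-edge : ∀ {n} (f : Fin n → Fin n) {x y} → f x ≢ f y → mapEdge f (edge x y) ≡ edge (f x) (f y)
mapEdge-edge f {x} {y} fx≢fy with edge-cases x y
... | inj₁ eq rewrite eq = refl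
... | inj₂ eq rewrite eq = edge-sym (λ fy≡fx → fx≢fy (sym fy≡fx))

module LeftInverse {n} (f g : Fin n → Fin n) (g∘f : ∀ x → g (f x) ≡ x) where

  f-≢ : ∀ {x y} → x ≢ y → f x ≢ f y
  f-≢ {x} {y} x≢y fx≡fy = x≢y (trans (sym (g∘f x)) (trans (cong g fx≡fy) (g∘f y)))

  mapEdge-inverse : ∀ {e} → Canonical e → mapEdge g (mapEdge f e) ≡ e
  mapEdge-inverse {a , b} canon with edge-cases (f a) (f b)
  ... | inj₁ eq rewrite eq | g∘f a | g∘f b = edge-of-canonical canon (inj₁ (refl , refl))
  ... | inj₂ eq rewrite eq | g∘f a | g∘f b = edge-of-canonical canon (inj₂ (refl , refl))

  mapEdge-injective : ∀ {e e′} → Canonical e → Canonical e′ → mapEdge f e ≡ mapEdge f e′ → e ≡ e′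
  mapEdge-injective {e} {e′} c c′ eq =
    trans (sym (mapEdge-inverse c)) (trans (cong (mapEdge g) eq) (mapEdge-inverse c′))

  ∈ₑ-mapEdge⁻ : ∀ {z e} → z ∈ₑ mapEdge f e → g z ∈ₑ e
  ∈ₑ-mapEdge⁻ z∈ = Sum.map back back (∈ₑ-edge⁻ z∈)
    where
    back : ∀ {z x} → z ≡ f x → g z ≡ x
    back {x = x} refl = g∘f x

  mapEdge-Disjoint : ∀ {e e′} → Disjoint e e′ → Disjoint (mapEdge f e) (mapEdge f e′)
  mapEdge-Disjoint apart z∈ z∈′ = apart (∈ₑ-mapEdge⁻ z∈) (∈ₑ-mapEdge⁻ z∈′)

-- The image of a list of edges M under a permutation π of the vertices, as a
-- sublist of the edges of a symmetric graph G: those edges whose preimage is in M.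
module Image {n} (G : Graph n) (sym-G : Symmetric G) (π : Permutation n n) where

  private
    π⁺ π⁻ : Fin n → Fin n
    π⁺ = π ⟨$⟩ʳ_
    π⁻ = π ⟨$⟩ˡ_
    module Fwd = LeftInverse π⁺ π⁻ (λ _ → inverseˡ π)
    module Bwd = LeftInverse π⁻ π⁺ (λ _ → inverseʳ π)

  image : List (Edge n) → List (Edge n)
  image M = filterᵇ (λ e → ⌊ mapEdge π⁻ e ∈ₗ? M ⌋) (edges G)

  AdjacentAlong : List (Edge n) → Set
  AdjacentAlong M = ∀ {e} → e ∈ₗ M → Adj G (π⁺ (proj₁ e)) (π⁺ (proj₂ e))

  ∈-image⁻ : ∀ {M e} → e ∈ₗ image M → e ∈ₗ edges G × mapEdge π⁻ e ∈ₗ M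
  ∈-image⁻ {M} e∈ with ∈-filterᵇ⁻ (λ e → ⌊ mapEdge π⁻ e ∈ₗ? M ⌋) {xs = edges G} e∈
  ... | e∈G , pre∈M = e∈G , toWitness pre∈M

  ∈-image⁺ : ∀ {M e} → Canonical e → e ∈ₗ M → Adj G (π⁺ (proj₁ e)) (π⁺ (proj₂ e)) →
             mapEdge π⁺ e ∈ₗ image M
  ∈-image⁺ {M} canon e∈ adj = ∈-filterᵇ⁺ _
    (edge∈edges sym-G (Fwd.f-≢ (Canonical⇒≢ canon)) adj)
    (fromWitness (subst (_∈ₗ M) (sym (Fwd.mapEdge-inverse canon)) e∈))

  image-canonical : ∀ {M e} → e ∈ₗ image M → Canonical e
  image-canonical e∈ = proj₁ (∈-edges⁻ (proj₁ (∈-image⁻ e∈)))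

  module _ {M} (mat : Matching M) (along : AdjacentAlong M) where
    open Matching mat

    image-Unique : Unique (image M)
    image-Unique = filterᵇ-Unique _ (edges-Unique G)

    -- π⁻ and π⁺ are mutually inverse injections between image M and M.
    image-length : length (image M) ≡ length M
    image-length = ≤-antisym
      (injection-≤ (mapEdge π⁻) image-Unique
        (λ i j → Bwd.mapEdge-injective (image-canonical i) (image-canonical j))
        (λ e∈ → proj₂ (∈-image⁻ e∈)))
      (injection-≤ (mapEdge π⁺) unique
        (λ i j → Fwd.mapEdge-injective (canonical i) (canonical j))
        (λ e∈ → ∈-image⁺ (canonical e∈) e∈ (along e∈)))

    image-disjoint : PairwiseDisjoint (image M)
    image-disjoint {e} {e′} e∈ e′∈ e≢e′ =
      subst₂ Disjoint (Bwd.mapEdge-inverse c) (Bwd.mapEdge-inverse c′) (Fwd.mapEdge-Disjoint apart)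
      where
      c  = image-canonical e∈
      c′ = image-canonical e′∈
      apart : Disjoint (mapEdge π⁻ e) (mapEdge π⁻ e′)
      apart = disjoint (proj₂ (∈-image⁻ e∈)) (proj₂ (∈-image⁻ e′∈))
                       (λ eq → e≢e′ (Bwd.mapEdge-injective c c′ eq))

    image-matching : image M ∈ₗ matchings G (length M)
    image-matching = ∈-matchings⁺ (filterᵇ∈sublists _ (edges G)) image-length
      (PairwiseDisjoint⇒isMatchingᵇ image-Unique image-disjoint)

  image-⊆ : ∀ {M M′ e} → image M ≡ image M′ → Matching M → AdjacentAlong M → e ∈ₗ M → e ∈ₗ M′
  image-⊆ {M} {M′} eq mat along e∈ =
    subst (_∈ₗ M′) (Fwd.mapEdge-inverse canon)
      (proj₂ (∈-image⁻ (subst (_ ∈ₗ_) eq (∈-image⁺ canon e∈ (along e∈)))))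
    where canon = Matching.canonical mat e∈

  image-injective : ∀ {xs M₁ M₂} → Unique xs → M₁ ∈ₗ sublists xs → M₂ ∈ₗ sublists xs →
                    Matching M₁ → Matching M₂ → AdjacentAlong M₁ → AdjacentAlong M₂ →
                    image M₁ ≡ image M₂ → M₁ ≡ M₂
  image-injective u M₁∈ M₂∈ mat₁ mat₂ along₁ along₂ eq =
    sublist-ext u M₁∈ M₂∈ (image-⊆ eq mat₁ along₁) (image-⊆ (sym eq) mat₂ along₂)

module _ {n : ℕ} where

  private
    ⌊≟⌋-refl : ∀ (x : Fin n) → ⌊ x ≟ᶠ x ⌋ ≡ true
    ⌊≟⌋-refl x = trans (isYes≗does (x ≟ᶠ x)) (dec-true (x ≟ᶠ x) refl)

  sameEdge-self : ∀ (a b : Fin n) → sameEdge a b a b ≡ true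
  sameEdge-self a b rewrite ⌊≟⌋-refl a | ⌊≟⌋-refl b = refl

  sameEdge-sym : ∀ (a b x y : Fin n) → sameEdge a b x y ≡ sameEdge a b y x
  sameEdge-sym a b x y
    rewrite ∧-comm ⌊ x ≟ᶠ a ⌋ ⌊ y ≟ᶠ b ⌋ | ∧-comm ⌊ x ≟ᶠ b ⌋ ⌊ y ≟ᶠ a ⌋ =
    ∨-comm (⌊ y ≟ᶠ b ⌋ ∧ ⌊ x ≟ᶠ a ⌋) (⌊ y ≟ᶠ a ⌋ ∧ ⌊ x ≟ᶠ b ⌋)

  sameEdge-true : ∀ {a b x y : Fin n} → sameEdge a b x y ≡ true → (x ≡ a × y ≡ b) ⊎ (x ≡ b × y ≡ a)
  sameEdge-true {a} {b} {x} {y} _  with x ≟ᶠ a | y ≟ᶠ b | x ≟ᶠ b | y ≟ᶠ a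
  sameEdge-true _  | yes x≡a | yes y≡b | _       | _       = inj₁ (x≡a , y≡b)
  sameEdge-true _  | _       | _       | yes x≡b | yes y≡a = inj₂ (x≡b , y≡a)
  sameEdge-true () | no _    | _       | no _    | _
  sameEdge-true () | no _    | _       | yes _   | no _
  sameEdge-true () | yes _   | no _    | no _    | _
  sameEdge-true () | yes _   | no _    | yes _   | no _

  sameEdge-false : ∀ {a b x y : Fin n} → ¬ ((x ≡ a × y ≡ b) ⊎ (x ≡ b × y ≡ a)) → sameEdge a b x y ≡ false
  sameEdge-false {a} {b} {x} {y} not-ends with sameEdge a b x y in eq
  ... | true  = ⊥-elim (not-ends (sameEdge-true eq))
  ... | false = refl

  moveEdge-sym : ∀ {G} (a b c d : Fin n) → Symmetric G → Symmetric (moveEdge G a b c d)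
  moveEdge-sym a b c d sym-G x y
    rewrite sameEdge-sym a b x y | sameEdge-sym c d x y | sym-G x y = refl

  moveEdge-keeps : ∀ {G} {a b c d x y : Fin n} → ¬ ((x ≡ a × y ≡ b) ⊎ (x ≡ b × y ≡ a)) →
                   Adj G x y → Adj (moveEdge G a b c d) x y
  moveEdge-keeps {G} {a} {b} {c} {d} {x} {y} not-ends adj
    rewrite sameEdge-false {a} {b} {x} {y} not-ends with sameEdge c d x y
  ... | true  = refl
  ... | false = adj

  moveEdge-adds : ∀ {G} {a b c d : Fin n} → ¬ ((c ≡ a × d ≡ b) ⊎ (c ≡ b × d ≡ a)) →
                  Adj (moveEdge G a b c d) c d
  moveEdge-adds {G} {a} {b} {c} {d} not-ends
    rewrite sameEdge-false {a} {b} {c} {d} not-ends | sameEdge-self c d = refl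

module _ {n : ℕ} where

  transpose-at-i : ∀ (i j : Fin n) → transpose i j i ≡ j
  transpose-at-i i j rewrite dec-true (i ≟ᶠ i) refl = refl

  transpose-at-j : ∀ {i j : Fin n} → i ≢ j → transpose i j j ≡ i
  transpose-at-j {i} {j} i≢j
    rewrite dec-false (j ≟ᶠ i) (λ j≡i → i≢j (sym j≡i)) | dec-true (j ≟ᶠ j) refl = refl

  transpose-elsewhere : ∀ {i j k : Fin n} → k ≢ i → k ≢ j → transpose i j k ≡ k
  transpose-elsewhere {i} {j} {k} k≢i k≢j rewrite dec-false (k ≟ᶠ i) k≢i | dec-false (k ≟ᶠ j) k≢j = refl

  two-members : ∀ {p : Subset n} {x y} → x ∈ p → y ∈ p → x ≢ y → 2 ≤ ∣ p ∣
  two-members {p} {x} {y} x∈p y∈p x≢y =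
    ≤-trans (s≤s (nonempty y∈p-x)) (x∈p⇒∣p-x∣<∣p∣ x∈p)
    where
    y∈p-x : y ∈ p - x
    y∈p-x = x∈p∧x∉q⇒x∈p─q y∈p (λ y∈⁅x⁆ → x≢y (sym (x∈⁅y⁆⇒x≡y x y∈⁅x⁆)))
    nonempty : ∀ {q : Subset n} {z} → z ∈ q → 1 ≤ ∣ q ∣
    nonempty z∈q = ≤-trans (s≤s z≤n) (x∈p⇒∣p-x∣<∣p∣ z∈q)

module EdgeMove {n} (G₁ : Graph n) (S : Subset n) (u₁ u₂ v₁ v₂ : Fin n)
  (sym-G₁ : Symmetric G₁)
  (outside-complete : ∀ x y → x ∈ ∁ S → y ∈ ∁ S → x ≢ y → Adj G₁ x y)
  (u₁∉S : u₁ ∉ S) (u₂∉S : u₂ ∉ S) (v₁∈S : v₁ ∈ S) (v₂∈S : v₂ ∈ S)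
  (u₁~v₁ : Adj G₁ u₁ v₁) (v₁≢v₂ : v₁ ≢ v₂)
  (u₂≁S : ∀ w → w ∈ S → ¬ Adj G₁ u₂ w) where

  private
    outside≢inside : ∀ {x y} → x ∉ S → y ∈ S → x ≢ y
    outside≢inside x∉S y∈S refl = x∉S y∈S

    ≢-sym : ∀ {x y : Fin n} → x ≢ y → y ≢ x
    ≢-sym x≢y y≡x = x≢y (sym y≡x)

    u₁≢v₁ = outside≢inside u₁∉S v₁∈S
    u₁≢v₂ = outside≢inside u₁∉S v₂∈S
    u₂≢v₁ = outside≢inside u₂∉S v₁∈S
    u₂≢v₂ = outside≢inside u₂∉S v₂∈S

    u₁≢u₂ : u₁ ≢ u₂
    u₁≢u₂ refl = u₂≁S v₁ v₁∈S u₁~v₁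

  G₂ : Graph n
  G₂ = moveEdge G₁ u₁ v₂ u₂ v₂

  G₂-sym : Symmetric G₂
  G₂-sym = moveEdge-sym u₁ v₂ u₂ v₂ sym-G₁

  G₂-keeps : ∀ {x y} → y ≢ u₁ → y ≢ v₂ → Adj G₁ x y → Adj G₂ x y
  G₂-keeps {x} {y} y≢u₁ y≢v₂ = moveEdge-keeps {G = G₁} {u₁} {v₂} {u₂} {v₂} {x} {y} λ
    { (inj₁ (_ , y≡v₂)) → y≢v₂ y≡v₂
    ; (inj₂ (_ , y≡u₁)) → y≢u₁ y≡u₁ }

  G₂-u₂v₂ : Adj G₂ u₂ v₂
  G₂-u₂v₂ = moveEdge-adds {G = G₁} {u₁} {v₂} {u₂} {v₂} λ
    { (inj₁ (u₂≡u₁ , _)) → u₁≢u₂ (sym u₂≡u₁)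
    ; (inj₂ (u₂≡v₂ , _)) → u₂≢v₂ u₂≡v₂ }

  -- Every neighbour y of u₂ lies outside S, hence is a neighbour of u₁ as well.
  toward-u₁ : ∀ {y} → y ≢ u₁ → y ≢ v₂ → Adj G₁ u₂ y → Adj G₂ u₁ y
  toward-u₁ {y} y≢u₁ y≢v₂ u₂~y = G₂-keeps y≢u₁ y≢v₂
    (outside-complete u₁ y (x∉p⇒x∈∁p u₁∉S) (x∉p⇒x∈∁p (λ y∈S → u₂≁S y y∈S u₂~y)) (≢-sym y≢u₁))

  σ : Permutation n n
  σ = Perm.transpose u₁ u₂

  swap-adjacent : ∀ {x y} → x ≢ u₁ → x ≢ v₂ → y ≢ u₁ → y ≢ v₂ → x ≢ y →
                  Adj G₁ x y → Adj G₂ (σ ⟨$⟩ʳ x) (σ ⟨$⟩ʳ y)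
  swap-adjacent {x} {y} x≢u₁ x≢v₂ y≢u₁ y≢v₂ x≢y x~y with x ≟ᶠ u₂ | y ≟ᶠ u₂
  ... | yes refl | yes refl = ⊥-elim (x≢y refl)
  ... | yes refl | no y≢u₂
    rewrite transpose-at-j u₁≢u₂ | transpose-elsewhere y≢u₁ y≢u₂ = toward-u₁ y≢u₁ y≢v₂ x~y
  ... | no x≢u₂ | yes refl
    rewrite transpose-elsewhere x≢u₁ x≢u₂ | transpose-at-j u₁≢u₂ =
    trans (G₂-sym x u₁) (toward-u₁ x≢u₁ x≢v₂ (trans (sym-G₁ u₂ x) x~y))
  ... | no x≢u₂ | no y≢u₂
    rewrite transpose-elsewhere x≢u₁ x≢u₂ | transpose-elsewhere y≢u₁ y≢u₂ = G₂-keeps y≢u₁ y≢v₂ x~y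

  e₁₂ : Edge n
  e₁₂ = edge u₁ v₂

  σ-u₁ : σ ⟨$⟩ʳ u₁ ≡ u₂
  σ-u₁ = transpose-at-i u₁ u₂

  σ-v₂ : σ ⟨$⟩ʳ v₂ ≡ v₂
  σ-v₂ = transpose-elsewhere (≢-sym u₁≢v₂) (≢-sym u₂≢v₂)

  moved-adjacent : Adj G₂ (σ ⟨$⟩ʳ proj₁ e₁₂) (σ ⟨$⟩ʳ proj₂ e₁₂)
  moved-adjacent = Adj-edge (σ ⟨$⟩ʳ_) {u₁} {v₂} G₂-sym (subst₂ (Adj G₂) (sym σ-u₁) (sym σ-v₂) G₂-u₂v₂)

  moves-to : mapEdge (σ ⟨$⟩ʳ_) e₁₂ ≡ edge u₂ v₂
  moves-to = trans (mapEdge-edge (σ ⟨$⟩ʳ_) {u₁} {v₂} (λ eq → u₂≢v₂ (trans (sym σ-u₁) (trans eq σ-v₂))))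
                   (cong₂ edge σ-u₁ σ-v₂)

  module Im = Image G₂ G₂-sym

  choice : ∀ {M} → Dec (e₁₂ ∈ₗ M) → Permutation n n
  choice (yes _) = σ
  choice (no _)  = Perm.id

  φ : List (Edge n) → List (Edge n)
  φ M = Im.image (choice (e₁₂ ∈ₗ? M)) M

  along-unswapped : ∀ {t M} → M ∈ₗ matchings G₁ t → e₁₂ ∉ₗ M → Im.AdjacentAlong Perm.id M
  along-unswapped {M = M} M∈ e₁₂∉M {e} e∈ with ∈-edges⁻ (matchings-⊆ M∈ e∈)
  ... | canon , e-adj = moveEdge-keeps {G = G₁} {u₁} {v₂} {u₂} {v₂} not-moved e-adj
    where
    not-moved : ¬ ((proj₁ e ≡ u₁ × proj₂ e ≡ v₂) ⊎ (proj₁ e ≡ v₂ × proj₂ e ≡ u₁))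
    not-moved ends = e₁₂∉M (subst (_∈ₗ M) (sym (edge-of-canonical canon (flip ends))) e∈)
      where
      flip : ∀ {a b x y : Fin n} → (a ≡ x × b ≡ y) ⊎ (a ≡ y × b ≡ x) → (x ≡ a × y ≡ b) ⊎ (x ≡ b × y ≡ a)
      flip (inj₁ (refl , refl)) = inj₁ (refl , refl)
      flip (inj₂ (refl , refl)) = inj₂ (refl , refl)

  along-swapped : ∀ {t M} → M ∈ₗ matchings G₁ t → e₁₂ ∈ₗ M → Im.AdjacentAlong σ M
  along-swapped M∈ e₁₂∈M {e} e∈ with e ≟ₑ e₁₂
  ... | yes refl = moved-adjacent
  ... | no e≢e₁₂ with ∈-edges⁻ (matchings-⊆ M∈ e∈)
  ...   | canon , e-adj =
    swap-adjacent (proj₁ (avoids (inj₁ refl))) (proj₂ (avoids (inj₁ refl)))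
                  (proj₁ (avoids (inj₂ refl))) (proj₂ (avoids (inj₂ refl)))
                  (Canonical⇒≢ canon) e-adj
    where
    -- e is disjoint from u₁v₂, so neither end of e is u₁ or v₂.
    avoids : ∀ {z} → z ∈ₑ e → z ≢ u₁ × z ≢ v₂
    avoids z∈e = (λ z≡u₁ → apart z∈e (∈ₑ-edge⁺ {x = u₁} {v₂} (inj₁ z≡u₁)))
               , (λ z≡v₂ → apart z∈e (∈ₑ-edge⁺ {x = u₁} {v₂} (inj₂ z≡v₂)))
      where apart = Matching.disjoint (matchings-Matching M∈) e∈ e₁₂∈M e≢e₁₂

  along : ∀ {t M} → M ∈ₗ matchings G₁ t → (d : Dec (e₁₂ ∈ₗ M)) → Im.AdjacentAlong (choice d) M
  along M∈ (yes e₁₂∈M) = along-swapped M∈ e₁₂∈M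
  along M∈ (no e₁₂∉M)  = along-unswapped M∈ e₁₂∉M

  φ-matching : ∀ {t M} → M ∈ₗ matchings G₁ t → φ M ∈ₗ matchings G₂ t
  φ-matching {M = M} M∈ =
    subst (λ s → φ M ∈ₗ matchings G₂ s) (proj₁ (proj₂ (∈-matchings⁻ M∈)))
      (Im.image-matching (choice (e₁₂ ∈ₗ? M)) (matchings-Matching M∈) (along M∈ (e₁₂ ∈ₗ? M)))

  -- u₂v₂ marks the matchings that were swapped.
  marked : ∀ {t M} → M ∈ₗ matchings G₁ t → e₁₂ ∈ₗ M → edge u₂ v₂ ∈ₗ Im.image σ M
  marked {M = M} M∈ e₁₂∈M = subst (_∈ₗ Im.image σ M) moves-to
    (Im.∈-image⁺ σ (edge-canonical u₁≢v₂) e₁₂∈M (along-swapped M∈ e₁₂∈M e₁₂∈M))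

  unmarked : ∀ {t M} → M ∈ₗ matchings G₁ t → edge u₂ v₂ ∉ₗ Im.image Perm.id M
  unmarked M∈ u₂v₂∈ = u₂≁S v₂ v₂∈S (edge∈edges⁻ sym-G₁ (matchings-⊆ M∈
    (subst (_∈ₗ _) (mapEdge-id (edge-canonical u₂≢v₂)) (proj₂ (Im.∈-image⁻ Perm.id u₂v₂∈)))))

  -- u₂v₂ ∈ φ M tells which case applies, and within each case φ is injective.
  φ-injective : ∀ {t M₁ M₂} → M₁ ∈ₗ matchings G₁ t → M₂ ∈ₗ matchings G₁ t → φ M₁ ≡ φ M₂ → M₁ ≡ M₂
  φ-injective {M₁ = M₁} {M₂} M₁∈ M₂∈ = by-cases (e₁₂ ∈ₗ? M₁) (e₁₂ ∈ₗ? M₂)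
    where
    by-cases : (d₁ : Dec (e₁₂ ∈ₗ M₁)) (d₂ : Dec (e₁₂ ∈ₗ M₂)) →
               Im.image (choice d₁) M₁ ≡ Im.image (choice d₂) M₂ → M₁ ≡ M₂
    by-cases (yes p₁) (yes p₂) = Im.image-injective σ (edges-Unique G₁)
      (proj₁ (∈-matchings⁻ M₁∈)) (proj₁ (∈-matchings⁻ M₂∈))
      (matchings-Matching M₁∈) (matchings-Matching M₂∈) (along-swapped M₁∈ p₁) (along-swapped M₂∈ p₂)
    by-cases (no q₁) (no q₂) = Im.image-injective Perm.id (edges-Unique G₁)
      (proj₁ (∈-matchings⁻ M₁∈)) (proj₁ (∈-matchings⁻ M₂∈))
      (matchings-Matching M₁∈) (matchings-Matching M₂∈) (along-unswapped M₁∈ q₁) (along-unswapped M₂∈ q₂)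
    by-cases (yes p₁) (no _) eq = ⊥-elim (unmarked M₂∈ (subst (_ ∈ₗ_) eq (marked M₁∈ p₁)))
    by-cases (no _) (yes p₂) eq = ⊥-elim (unmarked M₁∈ (subst (_ ∈ₗ_) (sym eq) (marked M₂∈ p₂)))

  C : List (Edge n)
  C = edge u₁ v₁ ∷ edge u₂ v₂ ∷ []

  C-apart : Disjoint (edge u₁ v₁) (edge u₂ v₂)
  C-apart z∈₁ z∈₂ with ∈ₑ-edge⁻ {x = u₁} {v₁} z∈₁ | ∈ₑ-edge⁻ {x = u₂} {v₂} z∈₂
  ... | inj₁ refl | inj₁ z≡u₂ = u₁≢u₂ z≡u₂
  ... | inj₁ refl | inj₂ z≡v₂ = u₁≢v₂ z≡v₂
  ... | inj₂ refl | inj₁ z≡u₂ = u₂≢v₁ (sym z≡u₂)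
  ... | inj₂ refl | inj₂ z≡v₂ = v₁≢v₂ z≡v₂

  C-Matching : Matching C
  C-Matching = record
    { unique    = (Disjoint⇒≢ C-apart ∷ []) ∷ [] ∷ []
    ; canonical = λ { (here refl) → edge-canonical u₁≢v₁ ; (there (here refl)) → edge-canonical u₂≢v₂ }
    ; disjoint  = λ
      { (here refl)         (here refl)         ne → ⊥-elim (ne refl)
      ; (here refl)         (there (here refl)) _  → C-apart
      ; (there (here refl)) (here refl)         _  → Disjoint-sym C-apart
      ; (there (here refl)) (there (here refl)) ne → ⊥-elim (ne refl) }
    }

  C-along : Im.AdjacentAlong Perm.id C
  C-along (here refl)         = Adj-edge (λ x → x) {u₁} {v₁} G₂-sym (G₂-keeps (≢-sym u₁≢v₁) v₁≢v₂ u₁~v₁)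
  C-along (there (here refl)) = Adj-edge (λ x → x) {u₂} {v₂} G₂-sym G₂-u₂v₂

  W : List (Edge n)
  W = Im.image Perm.id C

  W-matching : W ∈ₗ matchings G₂ 2
  W-matching = Im.image-matching Perm.id C-Matching C-along

  ∈W : ∀ {e} → e ∈ₗ C → e ∈ₗ W
  ∈W e∈ = subst (_∈ₗ W) (mapEdge-id canon) (Im.∈-image⁺ Perm.id canon e∈ (C-along e∈))
    where canon = Matching.canonical C-Matching e∈

  W-missed : ∀ {M} → M ∈ₗ matchings G₁ 2 → φ M ≢ W
  W-missed {M} M∈ = by-cases (e₁₂ ∈ₗ? M)
    where
    σ⁻¹-u₁ : σ ⟨$⟩ˡ u₁ ≡ u₂
    σ⁻¹-u₁ = transpose-at-j (≢-sym u₁≢u₂)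
    σ⁻¹-v₁ : σ ⟨$⟩ˡ v₁ ≡ v₁
    σ⁻¹-v₁ = transpose-elsewhere (≢-sym u₂≢v₁) (≢-sym u₁≢v₁)
    -- The preimage of u₁v₁ under σ is the non-edge u₂v₁.
    σ⁻¹-u₁v₁ : mapEdge (σ ⟨$⟩ˡ_) (edge u₁ v₁) ≡ edge u₂ v₁
    σ⁻¹-u₁v₁ = trans
      (mapEdge-edge (σ ⟨$⟩ˡ_) {u₁} {v₁} (λ eq → u₂≢v₁ (trans (sym σ⁻¹-u₁) (trans eq σ⁻¹-v₁))))
      (cong₂ edge σ⁻¹-u₁ σ⁻¹-v₁)
    by-cases : (d : Dec (e₁₂ ∈ₗ M)) → Im.image (choice d) M ≢ W
    by-cases (no _)  eq = unmarked M∈ (subst (_ ∈ₗ_) (sym eq) (∈W (there (here refl))))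
    by-cases (yes _) eq = u₂≁S v₁ v₁∈S (edge∈edges⁻ sym-G₁ (matchings-⊆ M∈
      (subst (_∈ₗ M) σ⁻¹-u₁v₁ (proj₂ (Im.∈-image⁻ σ (subst (_ ∈ₗ_) (sym eq) (∈W (here refl))))))))

  dominated : ∀ t → matchNum G₁ t ≤ matchNum G₂ t
  dominated t = injection-≤ φ (matchings-Unique G₁ t) φ-injective φ-matching

  strictly-more-2-matchings : matchNum G₁ 2 < matchNum G₂ 2
  strictly-more-2-matchings =
    injection-< φ W (matchings-Unique G₁ 2) φ-injective φ-matching W-matching W-missed

-- Lemma 2.3.  Only simplicity, completeness of G₁ outside S, the position of
-- u₁, u₂, v₁, v₂ and |S| = m ≤ ⌊n/2⌋ (which makes t = 2 admissible) are needed.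
lemma2p3 : (n k m : ℕ) (G₁ : Graph n) (S : Subset n) (u₁ u₂ v₁ v₂ : Fin n) →
    2 ≤ n → 1 ≤ k → k ≤ n ∸ 1 →
    IsSimple G₁ → Connected G₁ → EdgeConnectivity G₁ k →
    NonemptyProper S → length (cut G₁ S) ≡ k →
    InducedComplete G₁ S m → InducedComplete G₁ (∁ S) (n ∸ m) →
    k ≤ m → m ≤ ⌊ n /2⌋ →
    u₁ ∉ S → u₂ ∉ S → v₁ ∈ S → v₂ ∈ S →
    Adj G₁ u₁ v₁ → Adj G₁ u₁ v₂ → v₁ ≢ v₂ →
    (∀ w → w ∈ S → ¬ Adj G₁ u₂ w) →
    G₁ ≺ moveEdge G₁ u₁ v₂ u₂ v₂
lemma2p3 n _ _ G₁ S u₁ u₂ v₁ v₂ _ _ _ simple _ _ _ _ (∣S∣≡m , _) (_ , outside-complete) _ m≤⌊n/2⌋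
         u₁∉S u₂∉S v₁∈S v₂∈S u₁~v₁ _ v₁≢v₂ u₂≁S =
  (λ t _ → dominated t) , 2 , 2≤⌊n/2⌋ , strictly-more-2-matchings
  where
  open EdgeMove G₁ S u₁ u₂ v₁ v₂ (IsSimple.sym simple) outside-complete
                u₁∉S u₂∉S v₁∈S v₂∈S u₁~v₁ v₁≢v₂ u₂≁S
  2≤⌊n/2⌋ : 2 ≤ ⌊ n /2⌋
  2≤⌊n/2⌋ = ≤-trans (subst (2 ≤_) ∣S∣≡m (two-members v₁∈S v₂∈S v₁≢v₂)) m≤⌊n/2⌋
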